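{- For all binary words $u,v$, we have $m_{\mathsf{LCS}}(u,v)\le m_{\mathsf{SCS}}(u,v)$.
   Context: Words are finite strings over $\{0,1\}$. $w$ is a subsequence of $u$ (and $u$ a supersequence of $w$) if $w$ is obtained from $u$ by deleting some letters. A longest common subsequence (LCS) of $u,v$ is a common subsequence of maximum length; a shortest common supersequence (SCS) of $u,v$ is a word of minimum length containing both $u$ and $v$ as subsequences. $m_{\mathsf{LCS}}(u,v)$ (resp. $m_{\mathsf{SCS}}(u,v)$) is the number of distinct LCS's (resp. SCS's) of $u$ and $v$. -}

module Defs where

open import Data.Bool using (Bool; true; false)
import Data.Bool.Properties as BoolP
open import Data.Nat using (ℕ; zero; suc; _+_; _⊔_)
open import Data.List using (List; []; _∷_; map; _++_; filter; length; null)
open import Data.Product using (_×_)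
open import Relation.Nullary.Decidable using (_×-dec_)
open import Data.List.Relation.Binary.Sublist.Propositional using (_⊆_)
open import Data.List.Relation.Binary.Sublist.DecPropositional BoolP._≟_ using (_⊆?_)

-- Binary words: finite lists over {0,1}, with 0 = false, 1 = true.
Word : Set
Word = List Bool

-- w is a subsequence of u  ⇔  w ⊆ u  (stdlib's Sublist relation:
-- w obtained from u by deleting letters).

allWords : ℕ → List Word
allWords zero    = [] ∷ []
allWords (suc n) = map (false ∷_) (allWords n) ++ map (true ∷_) (allWords n)

commonSubseqsOfLength : Word → Word → ℕ → List Word
commonSubseqsOfLength u v k = filter (λ w → (w ⊆? u) ×-dec (w ⊆? v)) (allWords k)

commonSupseqsOfLength : Word → Word → ℕ → List Word
commonSupseqsOfLength u v k = filter (λ w → (u ⊆? w) ×-dec (v ⊆? w)) (allWords k)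

maxCSLen : Word → Word → ℕ → ℕ
maxCSLen u v zero    = zero
maxCSLen u v (suc n) with null (commonSubseqsOfLength u v (suc n))
... | true  = maxCSLen u v n
... | false = suc n

-- Length of an LCS: common subsequences have length ≤ |u|.
lcsLength : Word → Word → ℕ
lcsLength u v = maxCSLen u v (length u)

-- Smallest k in [k₀, k₀ + fuel] such that there is a common
-- supersequence of length k (returns k₀ + fuel if none before).
minCSupLenFrom : Word → Word → ℕ → ℕ → ℕ
minCSupLenFrom u v k₀ zero       = k₀
minCSupLenFrom u v k₀ (suc fuel) with null (commonSupseqsOfLength u v k₀)
... | true  = minCSupLenFrom u v (suc k₀) fuel
... | false = k₀

-- Length of an SCS: uv is a common supersequence, so the minimum is
-- attained at some k ≤ |u| + |v|.
scsLength : Word → Word → ℕ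
scsLength u v = minCSupLenFrom u v 0 (length u + length v)

mLCS : Word → Word → ℕ
mLCS u v = length (commonSubseqsOfLength u v (lcsLength u v))

mSCS : Word → Word → ℕ
mSCS u v = length (commonSupseqsOfLength u v (scsLength u v))

{-# OPTIONS --safe #-}

-- The lengths lcs and scs obey the classical dynamic-programming recursions,
-- and lcs u v + scs u v = |u| + |v|. If both words start with a, every
-- LCS of au, av starts with a, so it comes from an LCS of u, v, while every SCS of u, v
-- gives an SCS of au, av by prepending a. If the heads a ≠ b differ, an LCS of au, bv is
-- a common subsequence of u, bv or of au, v, and the SCSs of these two pairs, prefixed
-- by a and by b respectively, are distinct SCSs of au, bv.

module Submission where

open import Defs

open import Data.Bool using (Bool; true; false; not; if_then_else_)
open import Data.Bool.Properties using (_≟_; not-¬)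
open import Data.Nat using (ℕ; zero; suc; _+_; _⊔_; _⊓_; _≤_; _<_; z≤n; s≤s)
open import Data.Nat.Properties
  using ( ≤-reflexive; ≤-trans; ≤-antisym; ≤-total; ≤-pred; n≤0⇒n≡0
        ; ≤-<-trans; <-≤-trans; m≤n⇒m≤1+n; m≤n⇒m<n∨m≡n; <⇒≢; >⇒≢
        ; +-identityʳ; +-comm; +-suc; +-cancelˡ-≡; +-cancelˡ-≤; +-monoˡ-≤; +-monoʳ-≤; +-mono-≤; n≤1+n
        ; m≤m+n; m≤n+m; m≤m⊔n; m≤n⊔m; m⊓n≤m; m⊓n≤n
        ; ⊔-sel; ⊓-sel; m≤n⇒m⊔n≡n; m≥n⇒m⊔n≡m; m≤n⇒m⊓n≡m; m≥n⇒m⊓n≡n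
        ; module ≤-Reasoning )
open import Data.List using (List; []; _∷_; map; _++_; filter; length; null)
open import Data.List.Properties using (length-++; length-filter; filter-++)
open import Data.List.Relation.Binary.Sublist.Propositional using (_⊆_; []; _∷_; _∷ʳ_; ⊆-refl; minimum)
open import Data.List.Relation.Binary.Sublist.Propositional.Properties
  using (∷⁻; ∷ʳ⁻; length-mono-≤; filter⁺)
open import Data.List.Relation.Binary.Sublist.DecPropositional _≟_ using (_⊆?_)
open import Data.Product using (_×_; _,_; ∃-syntax)
open import Data.Sum using (_⊎_; inj₁; inj₂)
open import Data.Empty using (⊥-elim)
open import Function using (_∘_)
open import Level using (Level)
open import Relation.Nullary using (does; yes; no)
open import Relation.Nullary.Decidable using (_×-dec_)
open import Relation.Unary using (Pred; Decidable)
open import Relation.Binary.PropositionalEquality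
  using (_≡_; _≢_; refl; sym; trans; cong; cong₂; subst; module ≡-Reasoning)

private
  variable
    ℓ₁ ℓ₂ ℓ₃ : Level
    P Q R : Pred Word _
    a b : Bool

length-filter-map : ∀ {A B : Set} {P : Pred A ℓ₁} (P? : Decidable P) (f : B → A) (xs : List B) →
  length (filter P? (map f xs)) ≡ length (filter (P? ∘ f) xs)
length-filter-map P? f [] = refl
length-filter-map P? f (x ∷ xs) with P? (f x)
... | yes _ = cong suc (length-filter-map P? f xs)
... | no _  = length-filter-map P? f xs

m≤n+o⇒m≤n+1+o : ∀ {m n o} → m ≤ n + o → m ≤ n + suc o
m≤n+o⇒m≤n+1+o {n = n} m≤n+o = ≤-trans m≤n+o (+-monoʳ-≤ n (n≤1+n _))

length-filter-⊎ : ∀ {A : Set} {P : Pred A ℓ₁} {Q : Pred A ℓ₂} {R : Pred A ℓ₃}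
  (P? : Decidable P) (Q? : Decidable Q) (R? : Decidable R) →
  (∀ {x} → P x → Q x ⊎ R x) → (xs : List A) →
  length (filter P? xs) ≤ length (filter Q? xs) + length (filter R? xs)
length-filter-⊎ P? Q? R? P⇒Q⊎R [] = z≤n
length-filter-⊎ P? Q? R? P⇒Q⊎R (x ∷ xs)
  with P? x | Q? x | R? x | length-filter-⊎ P? Q? R? P⇒Q⊎R xs
... | yes _ | yes _ | yes _ | ih = s≤s (m≤n+o⇒m≤n+1+o ih)
... | yes _ | yes _ | no _  | ih = s≤s ih
... | yes _ | no _  | yes _ | ih = ≤-trans (s≤s ih) (≤-reflexive (sym (+-suc _ _)))
... | no _  | yes _ | yes _ | ih = m≤n⇒m≤1+n (m≤n+o⇒m≤n+1+o ih)
... | no _  | yes _ | no _  | ih = m≤n⇒m≤1+n ih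
... | no _  | no _  | yes _ | ih = m≤n+o⇒m≤n+1+o ih
... | no _  | no _  | no _  | ih = ih
... | yes p | no ¬q | no ¬r | _ with P⇒Q⊎R p
...   | inj₁ q = ⊥-elim (¬q q)
...   | inj₂ r = ⊥-elim (¬r r)

count : Decidable P → ℕ → ℕ
count P? k = length (filter P? (allWords k))

prefixed : (a : Bool) → Decidable P → Decidable (P ∘ (a ∷_))
prefixed a P? w = P? (a ∷ w)

count-suc : (P? : Decidable P) → a ≢ b → ∀ k →
  count P? (suc k) ≡ count (prefixed a P?) k + count (prefixed b P?) k
count-suc {a = false} {false} P? a≢b k = ⊥-elim (a≢b refl)
count-suc {a = true}  {true}  P? a≢b k = ⊥-elim (a≢b refl)
count-suc {a = false} {true}  P? a≢b k = begin
  length (filter P? (map (false ∷_) (allWords k) ++ map (true ∷_) (allWords k)))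
    ≡⟨ cong length (filter-++ P? (map (false ∷_) (allWords k)) _) ⟩
  length (filter P? (map (false ∷_) (allWords k)) ++ filter P? (map (true ∷_) (allWords k)))
    ≡⟨ length-++ (filter P? (map (false ∷_) (allWords k))) ⟩
  length (filter P? (map (false ∷_) (allWords k))) + length (filter P? (map (true ∷_) (allWords k)))
    ≡⟨ cong₂ _+_ (length-filter-map P? _ (allWords k)) (length-filter-map P? _ (allWords k)) ⟩
  count (prefixed false P?) k + count (prefixed true P?) k ∎
  where open ≡-Reasoning
count-suc {a = true}  {false} P? a≢b k =
  trans (count-suc P? (a≢b ∘ sym) k) (+-comm (count (prefixed false P?) k) _)

count-prefixed≤ : (P? : Decidable P) (a : Bool) (k : ℕ) → count (prefixed a P?) k ≤ count P? (suc k)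
count-prefixed≤ P? a k = ≤-trans (m≤m+n _ _) (≤-reflexive (sym (count-suc P? (not-¬ refl) k)))

count-mono : (P? : Decidable P) (Q? : Decidable Q) → (∀ {w} → P w → Q w) → ∀ k →
  count P? k ≤ count Q? k
count-mono P? Q? P⇒Q k = length-mono-≤ (filter⁺ P? Q? (λ { refl → P⇒Q }) (⊆-refl {x = allWords k}))

count-⊎ : (P? : Decidable P) (Q? : Decidable Q) (R? : Decidable R) →
  (∀ {w} → P w → Q w ⊎ R w) → ∀ k → count P? k ≤ count Q? k + count R? k
count-⊎ P? Q? R? P⇒Q⊎R k = length-filter-⊎ P? Q? R? P⇒Q⊎R (allWords k)

count-pos : (P? : Decidable P) → ∀ {w} → P w → 0 < count P? (length w)
count-pos P? {[]} p with P? []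
... | yes _ = s≤s z≤n
... | no ¬p = ⊥-elim (¬p p)
count-pos P? {a ∷ w} p = ≤-trans (count-pos (prefixed a P?) p) (count-prefixed≤ P? a (length w))

count-zero : (P? : Decidable P) → ∀ k → (∀ {w} → P w → length w ≢ k) → count P? k ≡ 0
count-zero P? zero ¬P with P? []
... | yes p = ⊥-elim (¬P p refl)
... | no _  = refl
count-zero P? (suc k) ¬P = begin
  count P? (suc k)                                    ≡⟨ count-suc P? (λ ()) k ⟩
  count (prefixed false P?) k + count (prefixed true P?) k
    ≡⟨ cong₂ _+_ (count-zero (prefixed false P?) k (λ p → ¬P p ∘ cong suc))
                 (count-zero (prefixed true P?) k (λ p → ¬P p ∘ cong suc)) ⟩
  0                                                   ∎
  where open ≡-Reasoning

CommonSubseq : Word → Word → Pred Word _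
CommonSubseq u v w = w ⊆ u × w ⊆ v

CommonSupseq : Word → Word → Pred Word _
CommonSupseq u v s = u ⊆ s × v ⊆ s

commonSubseq? : ∀ u v → Decidable (CommonSubseq u v)
commonSubseq? u v w = (w ⊆? u) ×-dec (w ⊆? v)

commonSupseq? : ∀ u v → Decidable (CommonSupseq u v)
commonSupseq? u v s = (u ⊆? s) ×-dec (v ⊆? s)

lcs : Word → Word → ℕ
lcs []      v       = 0
lcs (a ∷ u) []      = 0
lcs (a ∷ u) (b ∷ v) =
  if does (a ≟ b) then suc (lcs u v) else lcs u (b ∷ v) ⊔ lcs (a ∷ u) v

scs : Word → Word → ℕ
scs []      v       = length v
scs (a ∷ u) []      = length (a ∷ u)
scs (a ∷ u) (b ∷ v) =
  if does (a ≟ b) then suc (scs u v) else suc (scs u (b ∷ v) ⊓ scs (a ∷ u) v)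

lcs-upper : ∀ u v {w} → CommonSubseq u v w → length w ≤ lcs u v
lcs-upper []      v       ([] , _) = z≤n
lcs-upper (a ∷ u) []      (_ , []) = z≤n
lcs-upper (a ∷ u) (b ∷ v) {[]}    _       = z≤n
-- Recursive calls on (u, b ∷ v) and (a ∷ u, v) are made in the `with` header: inside a
-- with-clause the termination checker no longer sees that they are structurally smaller.
lcs-upper (a ∷ u) (b ∷ v) {c ∷ w} (p , q)
  with a ≟ b | p | lcs-upper u v | lcs-upper u (b ∷ v) | lcs-upper (a ∷ u) v
... | yes refl | _              | ih | _   | _   = s≤s (ih (∷⁻ p , ∷⁻ q))
... | no _     | _ ∷ʳ p′        | _  | ih₁ | _   = ≤-trans (ih₁ (p′ , q)) (m≤m⊔n _ _)
... | no a≢b   | p′@(refl ∷ _)  | _  | _   | ih₂ = ≤-trans (ih₂ (p′ , ∷ʳ⁻ a≢b q)) (m≤n⊔m _ _)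

lcs-attained : ∀ u v → ∃[ w ] CommonSubseq u v w × length w ≡ lcs u v
lcs-attained []      v       = [] , ([] , minimum v) , refl
lcs-attained (a ∷ u) []      = [] , (minimum _ , []) , refl
lcs-attained (a ∷ u) (b ∷ v)
  with a ≟ b | lcs-attained u v | lcs-attained u (b ∷ v) | lcs-attained (a ∷ u) v
... | yes refl | w , (p , q) , e | _ | _ = a ∷ w , (refl ∷ p , refl ∷ q) , cong suc e
... | no _ | _ | w₁ , (p₁ , q₁) , e₁ | w₂ , (p₂ , q₂) , e₂
  with ⊔-sel (lcs u (b ∷ v)) (lcs (a ∷ u) v)
...   | inj₁ e = w₁ , (a ∷ʳ p₁ , q₁) , trans e₁ (sym e)
...   | inj₂ e = w₂ , (p₂ , b ∷ʳ q₂) , trans e₂ (sym e)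

scs-lower : ∀ u v {s} → CommonSupseq u v s → scs u v ≤ length s
scs-lower []      v       (_ , q) = length-mono-≤ q
scs-lower (a ∷ u) []      (p , _) = length-mono-≤ p
scs-lower (a ∷ u) (b ∷ v) {c ∷ s} (p , q)
  with a ≟ b | p | scs-lower u v | scs-lower u (b ∷ v) | scs-lower (a ∷ u) v
... | yes refl | _         | ih | _   | _   = s≤s (ih (∷⁻ p , ∷⁻ q))
... | no a≢b   | refl ∷ p′ | _  | ih₁ | _   = s≤s (≤-trans (m⊓n≤m _ _) (ih₁ (p′ , ∷ʳ⁻ (a≢b ∘ sym) q)))
... | no _     | _ ∷ʳ p′   | _  | _   | ih₂ = s≤s (≤-trans (m⊓n≤n _ _) (ih₂ (p′ , ∷⁻ q)))

scs-attained : ∀ u v → ∃[ s ] CommonSupseq u v s × length s ≡ scs u v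
scs-attained []      v       = v , (minimum v , ⊆-refl) , refl
scs-attained (a ∷ u) []      = a ∷ u , (⊆-refl , minimum _) , refl
scs-attained (a ∷ u) (b ∷ v)
  with a ≟ b | scs-attained u v | scs-attained u (b ∷ v) | scs-attained (a ∷ u) v
... | yes refl | s , (p , q) , e | _ | _ = a ∷ s , (refl ∷ p , refl ∷ q) , cong suc e
... | no _ | _ | s₁ , (p₁ , q₁) , e₁ | s₂ , (p₂ , q₂) , e₂
  with ⊓-sel (scs u (b ∷ v)) (scs (a ∷ u) v)
...   | inj₁ e = a ∷ s₁ , (refl ∷ p₁ , a ∷ʳ q₁) , cong suc (trans e₁ (sym e))
...   | inj₂ e = b ∷ s₂ , (b ∷ʳ p₂ , refl ∷ q₂) , cong suc (trans e₂ (sym e))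

⊔+⊓≡ : ∀ m n o p {k} → m + n ≡ k → o + p ≡ k → m ⊔ o + n ⊓ p ≡ k
⊔+⊓≡ m n o p m+n≡k o+p≡k with ≤-total m o
... | inj₁ m≤o = trans (cong₂ _+_ (m≤n⇒m⊔n≡n m≤o) (m≥n⇒m⊓n≡n p≤n)) o+p≡k
  where
  p≤n : p ≤ n
  p≤n = +-cancelˡ-≤ m p n (≤-trans (+-monoˡ-≤ p m≤o) (≤-reflexive (trans o+p≡k (sym m+n≡k))))
... | inj₂ o≤m = trans (cong₂ _+_ (m≥n⇒m⊔n≡m o≤m) (m≤n⇒m⊓n≡m n≤p)) m+n≡k
  where
  n≤p : n ≤ p
  n≤p = +-cancelˡ-≤ o n p (≤-trans (+-monoˡ-≤ n o≤m) (≤-reflexive (trans m+n≡k (sym o+p≡k))))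

lcs+scs : ∀ u v → lcs u v + scs u v ≡ length u + length v
lcs+scs []      v       = refl
lcs+scs (a ∷ u) []      = sym (+-identityʳ _)
lcs+scs (a ∷ u) (b ∷ v)
  with a ≟ b | lcs+scs u v | lcs+scs u (b ∷ v) | lcs+scs (a ∷ u) v
... | yes refl | ih | _ | _ = cong suc (trans (+-suc _ _) (trans (cong suc ih) (sym (+-suc _ _))))
... | no _ | _ | ih₁ | ih₂ = trans (+-suc _ _) (cong suc
  (⊔+⊓≡ (lcs u (b ∷ v)) (scs u (b ∷ v)) (lcs (a ∷ u) v) (scs (a ∷ u) v)
        ih₁ (trans ih₂ (sym (+-suc _ _)))))

#subseqs : Word → Word → ℕ → ℕ
#subseqs u v = count (commonSubseq? u v)

#supseqs : Word → Word → ℕ → ℕ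
#supseqs u v = count (commonSupseq? u v)

#subseqs-above-lcs : ∀ u v {k} → lcs u v < k → #subseqs u v k ≡ 0
#subseqs-above-lcs u v lcs<k =
  count-zero (commonSubseq? u v) _ (λ c → <⇒≢ (≤-<-trans (lcs-upper u v c) lcs<k))

#supseqs-below-scs : ∀ u v {k} → k < scs u v → #supseqs u v k ≡ 0
#supseqs-below-scs u v k<scs =
  count-zero (commonSupseq? u v) _ (λ c → >⇒≢ (<-≤-trans k<scs (scs-lower u v c)))

-- With distinct heads, the two smaller pairs are compared at the lengths of the
-- larger pair, which are their own optima only for the branch attaining lcs.
CountBound : Word → Word → Set
CountBound u v = ∀ {k σ} → lcs u v ≤ k → k + σ ≡ length u + length v →
  #subseqs u v k ≤ #supseqs u v σ

#LCS≤#SCS⇒CountBound : ∀ u v → #subseqs u v (lcs u v) ≤ #supseqs u v (scs u v) → CountBound u v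
#LCS≤#SCS⇒CountBound u v optimal lcs≤k k+σ≡ with m≤n⇒m<n∨m≡n lcs≤k
... | inj₁ lcs<k = ≤-trans (≤-reflexive (#subseqs-above-lcs u v lcs<k)) z≤n
... | inj₂ refl with +-cancelˡ-≡ (lcs u v) _ _ (trans k+σ≡ (sym (lcs+scs u v)))
...   | refl = optimal

#LCS≤#SCS-same-head : ∀ a u v → #subseqs u v (lcs u v) ≤ #supseqs u v (scs u v) →
  #subseqs (a ∷ u) (a ∷ v) (suc (lcs u v)) ≤ #supseqs (a ∷ u) (a ∷ v) (suc (scs u v))
#LCS≤#SCS-same-head a u v optimal = begin
  count CS (suc ℓ)                                   ≡⟨ count-suc CS (not-¬ refl) ℓ ⟩
  count (prefixed a CS) ℓ + count (prefixed (not a) CS) ℓ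
                                                     ≡⟨ cong (count (prefixed a CS) ℓ +_) no-other-head ⟩
  count (prefixed a CS) ℓ + 0                        ≡⟨ +-identityʳ _ ⟩
  count (prefixed a CS) ℓ                            ≤⟨ count-mono _ (commonSubseq? u v) (λ (p , q) → ∷⁻ p , ∷⁻ q) ℓ ⟩
  #subseqs u v ℓ                                     ≤⟨ optimal ⟩
  #supseqs u v σ                                     ≤⟨ count-mono _ (prefixed a SS) (λ (p , q) → refl ∷ p , refl ∷ q) σ ⟩
  count (prefixed a SS) σ                            ≤⟨ count-prefixed≤ SS a σ ⟩
  count SS (suc σ)                                   ∎
  where
  open ≤-Reasoning
  ℓ = lcs u v
  σ = scs u v
  CS = commonSubseq? (a ∷ u) (a ∷ v)
  SS = commonSupseq? (a ∷ u) (a ∷ v)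
  not-a≢a : not a ≢ a
  not-a≢a = not-¬ refl ∘ sym
  no-other-head : count (prefixed (not a) CS) ℓ ≡ 0
  no-other-head = count-zero _ ℓ (λ (p , q) → <⇒≢ (lcs-upper u v (∷ʳ⁻ not-a≢a p , ∷ʳ⁻ not-a≢a q)))

#LCS≤#SCS-different-heads : ∀ {a b} u v → a ≢ b → CountBound u (b ∷ v) → CountBound (a ∷ u) v →
  #subseqs (a ∷ u) (b ∷ v) (lcs u (b ∷ v) ⊔ lcs (a ∷ u) v)
    ≤ #supseqs (a ∷ u) (b ∷ v) (suc (scs u (b ∷ v) ⊓ scs (a ∷ u) v))
#LCS≤#SCS-different-heads {a} {b} u v a≢b bound₁ bound₂ = begin
  #subseqs (a ∷ u) (b ∷ v) ℓ
    ≤⟨ count-⊎ _ (commonSubseq? u (b ∷ v)) (commonSubseq? (a ∷ u) v) drop-a-or-b ℓ ⟩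
  #subseqs u (b ∷ v) ℓ + #subseqs (a ∷ u) v ℓ
    ≤⟨ +-mono-≤ (bound₁ {ℓ} {σ} (m≤m⊔n _ _) (trans ℓ+σ≡ (sym (+-suc _ _))))
                (bound₂ {ℓ} {σ} (m≤n⊔m _ _) ℓ+σ≡) ⟩
  #supseqs u (b ∷ v) σ + #supseqs (a ∷ u) v σ
    ≤⟨ +-mono-≤ (count-mono _ (prefixed a SS) (λ (p , q) → refl ∷ p , a ∷ʳ q) σ)
                (count-mono _ (prefixed b SS) (λ (p , q) → b ∷ʳ p , refl ∷ q) σ) ⟩
  count (prefixed a SS) σ + count (prefixed b SS) σ
    ≡⟨ count-suc SS a≢b σ ⟨
  count SS (suc σ) ∎
  where
  open ≤-Reasoning
  ℓ = lcs u (b ∷ v) ⊔ lcs (a ∷ u) v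
  σ = scs u (b ∷ v) ⊓ scs (a ∷ u) v
  SS = commonSupseq? (a ∷ u) (b ∷ v)
  ℓ+σ≡ : ℓ + σ ≡ suc (length u + length v)
  ℓ+σ≡ = ⊔+⊓≡ (lcs u (b ∷ v)) (scs u (b ∷ v)) (lcs (a ∷ u) v) (scs (a ∷ u) v)
               (trans (lcs+scs u (b ∷ v)) (+-suc _ _)) (lcs+scs (a ∷ u) v)
  drop-a-or-b : ∀ {w} → CommonSubseq (a ∷ u) (b ∷ v) w → CommonSubseq u (b ∷ v) w ⊎ CommonSubseq (a ∷ u) v w
  drop-a-or-b (_ ∷ʳ p , q)         = inj₁ (p , q)
  drop-a-or-b (p@(refl ∷ _) , q) = inj₂ (p , ∷ʳ⁻ a≢b q)

#LCS≤#SCS : ∀ u v → #subseqs u v (lcs u v) ≤ #supseqs u v (scs u v)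
#LCS≤#SCS []      v       = ≤-trans (length-filter (commonSubseq? [] v) (allWords 0))
  (count-pos (commonSupseq? [] v) {v} (minimum v , ⊆-refl))
#LCS≤#SCS (a ∷ u) []      = ≤-trans (length-filter (commonSubseq? (a ∷ u) []) (allWords 0))
  (count-pos (commonSupseq? (a ∷ u) []) {a ∷ u} (⊆-refl , minimum (a ∷ u)))
#LCS≤#SCS (a ∷ u) (b ∷ v)
  with a ≟ b | #LCS≤#SCS u v | #LCS≤#SCS u (b ∷ v) | #LCS≤#SCS (a ∷ u) v
... | yes refl | optimal | _        | _        = #LCS≤#SCS-same-head a u v optimal
... | no a≢b   | _       | optimal₁ | optimal₂ = #LCS≤#SCS-different-heads u v a≢b
  (#LCS≤#SCS⇒CountBound u (b ∷ v) optimal₁) (#LCS≤#SCS⇒CountBound (a ∷ u) v optimal₂)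

null⇒length≡0 : ∀ {A : Set} {xs : List A} → null xs ≡ true → length xs ≡ 0
null⇒length≡0 {xs = []} _ = refl

¬null⇒length>0 : ∀ {A : Set} {xs : List A} → null xs ≡ false → 0 < length xs
¬null⇒length>0 {xs = _ ∷ _} _ = s≤s z≤n

#LCS>0 : ∀ u v → 0 < #subseqs u v (lcs u v)
#LCS>0 u v with lcs-attained u v
... | w , c , e = subst (λ k → 0 < #subseqs u v k) e (count-pos (commonSubseq? u v) c)

#SCS>0 : ∀ u v → 0 < #supseqs u v (scs u v)
#SCS>0 u v with scs-attained u v
... | s , c , e = subst (λ k → 0 < #supseqs u v k) e (count-pos (commonSupseq? u v) c)

lcs≤length : ∀ u v → lcs u v ≤ length u
lcs≤length u v with lcs-attained u v
... | w , (p , _) , e = subst (_≤ length u) e (length-mono-≤ p)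

maxCSLen≡lcs : ∀ u v n → lcs u v ≤ n → maxCSLen u v n ≡ lcs u v
maxCSLen≡lcs u v zero    lcs≤0   = sym (n≤0⇒n≡0 lcs≤0)
maxCSLen≡lcs u v (suc n) lcs≤1+n
  with null (commonSubseqsOfLength u v (suc n)) in null≡ | m≤n⇒m<n∨m≡n lcs≤1+n
... | true  | inj₁ lcs<1+n = maxCSLen≡lcs u v n (≤-pred lcs<1+n)
... | false | inj₂ lcs≡1+n = sym lcs≡1+n
... | true  | inj₂ lcs≡1+n =
  ⊥-elim (<⇒≢ (subst (λ k → 0 < #subseqs u v k) lcs≡1+n (#LCS>0 u v)) (sym (null⇒length≡0 null≡)))
... | false | inj₁ lcs<1+n =
  ⊥-elim (<⇒≢ (¬null⇒length>0 null≡) (sym (#subseqs-above-lcs u v lcs<1+n)))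

minCSupLenFrom≡scs : ∀ u v k fuel → k ≤ scs u v → scs u v ≤ k + fuel →
  minCSupLenFrom u v k fuel ≡ scs u v
minCSupLenFrom≡scs u v k zero k≤scs scs≤k+0 =
  ≤-antisym k≤scs (subst (scs u v ≤_) (+-identityʳ k) scs≤k+0)
minCSupLenFrom≡scs u v k (suc fuel) k≤scs scs≤k+1+fuel
  with null (commonSupseqsOfLength u v k) in null≡ | m≤n⇒m<n∨m≡n k≤scs
... | true  | inj₁ k<scs =
  minCSupLenFrom≡scs u v (suc k) fuel k<scs (subst (scs u v ≤_) (+-suc k fuel) scs≤k+1+fuel)
... | false | inj₂ k≡scs = k≡scs
... | true  | inj₂ refl = ⊥-elim (<⇒≢ (#SCS>0 u v) (sym (null⇒length≡0 null≡)))
... | false | inj₁ k<scs = ⊥-elim (<⇒≢ (¬null⇒length>0 null≡) (sym (#supseqs-below-scs u v k<scs)))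

lcsLength≡lcs : ∀ u v → lcsLength u v ≡ lcs u v
lcsLength≡lcs u v = maxCSLen≡lcs u v (length u) (lcs≤length u v)

scsLength≡scs : ∀ u v → scsLength u v ≡ scs u v
scsLength≡scs u v = minCSupLenFrom≡scs u v 0 (length u + length v) z≤n
  (subst (scs u v ≤_) (lcs+scs u v) (m≤n+m (scs u v) (lcs u v)))

proposition1p2 : (u v : Word) → mLCS u v ≤ mSCS u v
proposition1p2 u v = begin
  mLCS u v                    ≡⟨ cong (#subseqs u v) (lcsLength≡lcs u v) ⟩
  #subseqs u v (lcs u v)      ≤⟨ #LCS≤#SCS u v ⟩
  #supseqs u v (scs u v)      ≡⟨ cong (#supseqs u v) (scsLength≡scs u v) ⟨
  mSCS u v                    ∎
  where open ≤-Reasoning
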